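{- Let $A$ be an admissible set of addition chains and $n$ a positive integer. Then: (1) $\delta^A_{st}(n)=\min_{k\ge0}\delta^A(2^k n)$; (2) $\delta^A_{st}(n)$ is the smallest $\alpha\in\mathscr{D}^A$ such that $\alpha\equiv\delta^A(n)\pmod 1$.
   Context: An addition chain for a positive integer $n$ is a sequence $(a_0,\ldots,a_r)$ with $a_0=1$, $a_r=n$, and for every $1\le k\le r$ there exist $0\le i,j<k$ with $a_k=a_i+a_j$; $r$ is its length. For a set $A$ of addition chains, $\ell^A(n)$ is the least length of an addition chain for $n$ belonging to $A$. $\nu_2(n)$ is the number of $1$'s in the binary expansion of $n$. $A$ is admissible if (i) for every $n\ge1$, $\ell^A(n)$ is defined and $\ell^A(n)\le\lfloor\log_2 n\rfloor+\nu_2(n)-1$, and (ii) for every $n\ge1$, $\ell^A(2n)\le\ell^A(n)+1$. The $A$-defect is $\delta^A(n)=\ell^A(n)-\log_2 n$, and $\mathscr{D}^A=\{\delta^A(n):n\ge1\}$. A positive integer $m$ is $A$-stable if $\ell^A(2^k m)=\ell^A(m)+k$ for all $k\ge0$. For every $n$ there exists $k\ge0$ with $2^kn$ $A$-stable, and the stable defect $\delta^A_{st}(n)$ is defined as $\delta^A(2^k n)$ for any $k\ge0$ such that $2^k n$ is $A$-stable (this value does not depend on the choice of such $k$). -}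

module Defs where

open import Level using (Level; suc; zero) renaming (_⊔_ to _⊔ℓ_)
open import Data.Nat using (ℕ; zero; suc; _+_; _*_; _∸_; _^_; _≤_; _<_; ⌊_/2⌋; _%_)
open import Data.Nat.Logarithm using (⌊log₂_⌋)
open import Data.Fin using (Fin; toℕ; fromℕ)
open import Data.Product using (Σ; _×_; ∃; ∃-syntax)
open import Data.Sum using (_⊎_)
open import Relation.Binary.PropositionalEquality using (_≡_)

record AdditionChain : Set where
  field
    len   : ℕ
    a     : Fin (Data.Nat.suc len) → ℕ
    start : a Data.Fin.zero ≡ 1
    step  : (k : Fin (Data.Nat.suc len)) → 0 < toℕ k →
            ∃[ i ] ∃[ j ] (toℕ i < toℕ k × toℕ j < toℕ k × a k ≡ a i + a j)
open AdditionChain public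

ChainFor : AdditionChain → ℕ → Set
ChainFor c n = a c (fromℕ (len c)) ≡ n

ChainSet : Set₁
ChainSet = AdditionChain → Set

IsMinLen : ChainSet → ℕ → ℕ → Set
IsMinLen A n r =
  (Σ AdditionChain λ c → A c × ChainFor c n × len c ≡ r) ×
  ((c : AdditionChain) → A c → ChainFor c n → r ≤ len c)

IsLeastLength : ChainSet → (ℕ → ℕ) → Set
IsLeastLength A ℓ = (n : ℕ) → 1 ≤ n → IsMinLen A n (ℓ n)

-- ν₂ n : number of 1's in the binary expansion of n (fuel n suffices).
ν₂-go : ℕ → ℕ → ℕ
ν₂-go zero    m = 0
ν₂-go (suc f) m = m % 2 + ν₂-go f ⌊ m /2⌋

ν₂ : ℕ → ℕ
ν₂ n = ν₂-go n n

Admissible : ChainSet → (ℕ → ℕ) → Set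
Admissible A ℓ =
  ((n : ℕ) → 1 ≤ n → ℓ n ≤ ⌊log₂ n ⌋ + ν₂ n ∸ 1) ×
  ((n : ℕ) → 1 ≤ n → ℓ (2 * n) ≤ ℓ n + 1)

-- Defects δ(m) = ℓ(m) - log₂ m, compared exactly without reals
-- (for m, m' ≥ 1):
--   δ(m) ≤ δ(m')  iff  2^ℓ(m) * m' ≤ 2^ℓ(m') * m
--   δ(m) = δ(m')  iff  2^ℓ(m) * m' = 2^ℓ(m') * m
DefectLe : (ℕ → ℕ) → ℕ → ℕ → Set
DefectLe ℓ m m' = 2 ^ ℓ m * m' ≤ 2 ^ ℓ m' * m

DefectEq : (ℕ → ℕ) → ℕ → ℕ → Set
DefectEq ℓ m m' = 2 ^ ℓ m * m' ≡ 2 ^ ℓ m' * m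

-- δ(m) ≡ δ(m') (mod 1), i.e. log₂ m - log₂ m' ∈ ℤ, i.e. m/m' is an
-- integral power of 2 (for m, m' ≥ 1).
DefectCong : ℕ → ℕ → Set
DefectCong m m' = ∃[ j ] (m ≡ 2 ^ j * m' ⊎ m' ≡ 2 ^ j * m)

-- The real number δ(m) belongs to 𝒟^A = { δ(x) : x ≥ 1 }.
InDefects : (ℕ → ℕ) → ℕ → Set
InDefects ℓ m = ∃[ x ] (1 ≤ x × DefectEq ℓ m x)

Stable : (ℕ → ℕ) → ℕ → Set
Stable ℓ m = (k : ℕ) → ℓ (2 ^ k * m) ≡ ℓ m + k

-- Doubling costs at most one step, so along x, 2x, 4x, … the defect never
-- increases, while from a stable point s on it is constant.  Every m with
-- m/s a power of two lies on such a chain either below s (then δ(s) ≤ δ(m)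
-- by monotonicity) or above s (then δ(m) = δ(s) by stability); hence δ(s) is
-- the minimum over the whole class δ(n) + ℤ, which contains all δ(2ʲ n).
{-# OPTIONS --safe #-}
module Submission where

open import Defs
open import Data.Nat using (ℕ; zero; suc; _+_; _*_; _^_; _≤_)
open import Data.Nat.Properties
open import Data.Product using (_×_; _,_)
open import Data.Sum using (inj₁; inj₂)
open import Relation.Binary.PropositionalEquality

2^[a+b]*x≡2^a*[2^b*x] : ∀ a b x → 2 ^ (a + b) * x ≡ 2 ^ a * (2 ^ b * x)
2^[a+b]*x≡2^a*[2^b*x] a b x = trans (cong (_* x) (^-distribˡ-+-* 2 a b)) (*-assoc (2 ^ a) (2 ^ b) x)

2^[a+b]*x≡2^b*[2^a*x] : ∀ a b x → 2 ^ (a + b) * x ≡ 2 ^ b * (2 ^ a * x)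
2^[a+b]*x≡2^b*[2^a*x] a b x = trans (cong (λ e → 2 ^ e * x) (+-comm a b)) (2^[a+b]*x≡2^a*[2^b*x] b a x)

2^a*x-positive : ∀ a {x} → 1 ≤ x → 1 ≤ 2 ^ a * x
2^a*x-positive a x≥1 = *-mono-≤ (m^n>0 2 a) x≥1

DefectCong-*2^ʳ : ∀ k {m n} → DefectCong m n → DefectCong m (2 ^ k * n)
DefectCong-*2^ʳ k {n = n} (j , inj₁ refl) with ≤-total k j
... | inj₁ k≤j with d , refl ← m≤n⇒∃[o]m+o≡n k≤j = d , inj₁ (2^[a+b]*x≡2^b*[2^a*x] k d n)
... | inj₂ j≤k with d , refl ← m≤n⇒∃[o]m+o≡n j≤k = d , inj₂ (2^[a+b]*x≡2^b*[2^a*x] j d n)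
DefectCong-*2^ʳ k {m} (j , inj₂ refl) = k + j , inj₂ (sym (2^[a+b]*x≡2^a*[2^b*x] k j m))

module _ (ℓ : ℕ → ℕ) where

  DefectLe-2^*ˡ : ∀ d x → ℓ (2 ^ d * x) ≤ ℓ x + d → DefectLe ℓ (2 ^ d * x) x
  DefectLe-2^*ˡ d x ℓ≤ = begin
    2 ^ ℓ (2 ^ d * x) * x  ≤⟨ *-monoˡ-≤ x (^-monoʳ-≤ 2 ℓ≤) ⟩
    2 ^ (ℓ x + d) * x      ≡⟨ 2^[a+b]*x≡2^a*[2^b*x] (ℓ x) d x ⟩
    2 ^ ℓ x * (2 ^ d * x)  ∎
    where open ≤-Reasoning

  DefectLe-2^*ʳ : ∀ d x → ℓ x + d ≤ ℓ (2 ^ d * x) → DefectLe ℓ x (2 ^ d * x)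
  DefectLe-2^*ʳ d x ≤ℓ = begin
    2 ^ ℓ x * (2 ^ d * x)  ≡⟨ 2^[a+b]*x≡2^a*[2^b*x] (ℓ x) d x ⟨
    2 ^ (ℓ x + d) * x      ≤⟨ *-monoˡ-≤ x (^-monoʳ-≤ 2 ≤ℓ) ⟩
    2 ^ ℓ (2 ^ d * x) * x  ∎
    where open ≤-Reasoning

  DoublingBounded : Set
  DoublingBounded = ∀ x → 1 ≤ x → ℓ (2 * x) ≤ ℓ x + 1

  module _ (doubling : DoublingBounded) where

    ℓ-2^*-≤ : ∀ a x → 1 ≤ x → ℓ (2 ^ a * x) ≤ ℓ x + a
    ℓ-2^*-≤ zero x _ rewrite *-identityˡ x | +-identityʳ (ℓ x) = ≤-refl
    ℓ-2^*-≤ (suc a) x x≥1 = begin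
      ℓ (2 * 2 ^ a * x)    ≡⟨ cong ℓ (*-assoc 2 (2 ^ a) x) ⟩
      ℓ (2 * (2 ^ a * x))  ≤⟨ doubling (2 ^ a * x) (2^a*x-positive a x≥1) ⟩
      ℓ (2 ^ a * x) + 1    ≤⟨ +-monoˡ-≤ 1 (ℓ-2^*-≤ a x x≥1) ⟩
      ℓ x + a + 1          ≡⟨ +-assoc (ℓ x) a 1 ⟩
      ℓ x + (a + 1)        ≡⟨ cong (ℓ x +_) (+-comm a 1) ⟩
      ℓ x + suc a          ∎
      where open ≤-Reasoning

    Stable⇒DefectLe-cong : ∀ {s} → Stable ℓ s →
                           ∀ m → 1 ≤ m → DefectCong m s → DefectLe ℓ s m
    Stable⇒DefectLe-cong {s} stable m _ (j , inj₁ refl) =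
      DefectLe-2^*ʳ j s (≤-reflexive (sym (stable j)))
    Stable⇒DefectLe-cong stable m m≥1 (j , inj₂ refl) =
      DefectLe-2^*ˡ j m (ℓ-2^*-≤ j m m≥1)

proposition3p9 : (A : ChainSet) (ℓ : ℕ → ℕ) → IsLeastLength A ℓ → Admissible A ℓ →
    (n : ℕ) → 1 ≤ n →
    (k : ℕ) → Stable ℓ (2 ^ k * n) →
      ((j : ℕ) → DefectLe ℓ (2 ^ k * n) (2 ^ j * n)) ×
      (InDefects ℓ (2 ^ k * n) × DefectCong (2 ^ k * n) n ×
        ((m : ℕ) → 1 ≤ m → DefectCong m n → DefectLe ℓ (2 ^ k * n) m))
proposition3p9 _ ℓ _ (_ , doubling) n n≥1 k stable =
    (λ j → minimal (2 ^ j * n) (2^a*x-positive j n≥1) (j , inj₁ refl))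
  , (2 ^ k * n , 2^a*x-positive k n≥1 , refl)
  , (k , inj₁ refl)
  , minimal
  where
  minimal : ∀ m → 1 ≤ m → DefectCong m n → DefectLe ℓ (2 ^ k * n) m
  minimal m m≥1 m~n =
    Stable⇒DefectLe-cong ℓ doubling stable m m≥1 (DefectCong-*2^ʳ k m~n)
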